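{- Let $F$ be a CNF formula, $c \in F$, and $c'$ a clause with $c' \subsetneq c$ and $F \models c'$. Then $c$ is superredundant in $F$.
   Context: A CNF formula is a finite set of clauses; a clause is a finite set of literals, read as their disjunction. Tautological clauses are not allowed. Resolution: from clauses $c_1 \vee l$ and $c_2 \vee \neg l$ derive $c_1 \vee c_2$; two clauses whose resolvent would be a tautology are considered not to resolve. The resolution closure $\mathrm{ResCn}(F)$ is the set of all clauses obtainable from $F$ by zero or more resolution steps. A clause $c \in F$ is superredundant in $F$ if $\mathrm{ResCn}(F) \setminus \{c\} \models c$. -}

module Defs where

open import Data.Nat using (ℕ)
open import Data.Bool using (Bool; true; false; not)
open import Data.List using (List)
open import Data.List.Membership.Propositional using (_∈_; _∉_)
open import Data.List.Relation.Unary.Any using (Any)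
open import Data.List.Relation.Unary.All using (All)
open import Data.Product using (Σ; ∃; _×_)
open import Data.Sum using (_⊎_)
open import Relation.Nullary using (¬_)
open import Relation.Binary.PropositionalEquality using (_≡_; _≢_)
open import Function.Bundles using (_⇔_)

data Lit : Set where
  pos : ℕ → Lit
  neg : ℕ → Lit

-- A clause is a finite set of literals, represented by a list
-- (only membership matters; see _≈_ below).
Clause : Set
Clause = List Lit

CNF : Set
CNF = List Clause

_≈_ : Clause → Clause → Set
c ≈ d = ∀ l → (l ∈ c) ⇔ (l ∈ d)

_⊆_ : Clause → Clause → Set
c ⊆ d = ∀ {l} → l ∈ c → l ∈ d

_⊊_ : Clause → Clause → Set
c ⊊ d = (c ⊆ d) × (∃ λ l → (l ∈ d) × (l ∉ c))

Tautology : Clause → Set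
Tautology c = ∃ λ v → (pos v ∈ c) × (neg v ∈ c)

WellFormed : CNF → Set
WellFormed F = All (λ d → ¬ Tautology d) F

Assignment : Set
Assignment = ℕ → Bool

evalLit : Assignment → Lit → Bool
evalLit α (pos v) = α v
evalLit α (neg v) = not (α v)

Sat : Assignment → Clause → Set
Sat α c = Any (λ l → evalLit α l ≡ true) c

_⊨_ : CNF → Clause → Set
F ⊨ c = ∀ (α : Assignment) → All (Sat α) F → Sat α c

IsResolvent : Clause → Clause → ℕ → Clause → Set
IsResolvent d₁ d₂ v r =
  ∀ l → (l ∈ r) ⇔ (((l ∈ d₁) × (l ≢ pos v)) ⊎ ((l ∈ d₂) × (l ≢ neg v)))

-- Resolution closure ResCn(F), as a predicate on clauses (closed under
-- set equality of clauses). Resolution steps yielding a tautology are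
-- not allowed.
data ResCn (F : CNF) : Clause → Set where
  base : ∀ {d d'} → d' ∈ F → d ≈ d' → ResCn F d
  res  : ∀ {d₁ d₂ r} (v : ℕ) → ResCn F d₁ → ResCn F d₂ →
         pos v ∈ d₁ → neg v ∈ d₂ → IsResolvent d₁ d₂ v r →
         ¬ Tautology r → ResCn F r

-- c is superredundant in F: ResCn(F) ∖ {c} ⊨ c.
Superredundant : CNF → Clause → Set
Superredundant F c =
  ∀ (α : Assignment) →
    (∀ d → ResCn F d → ¬ (d ≈ c) → Sat α d) → Sat α c

{-# OPTIONS --safe #-}
-- Suppose α falsifies c but satisfies every other clause of ResCn(F), and pick
-- l ∈ c ∖ c'. Flipping the variable of l gives β, which satisfies c but still
-- falsifies c'; as F ⊨ c', β falsifies some d ∈ F, so d ≠ c and α satisfies d.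
-- Only the flipped variable changed, so ¬l ∈ d. The resolvent of c and d on l is
-- then falsified by α (hence not a tautology) and differs from c (it lacks l),
-- contradicting the choice of α.
module Submission where

open import Defs
open import Data.Bool using (true; false; not)
open import Data.Bool.Properties using (¬-not) renaming (_≟_ to _≟ᵇ_)
open import Data.Empty using (⊥; ⊥-elim)
open import Data.List using (_++_; filter)
open import Data.List.Membership.Propositional using (_∈_; _∉_; find; lose)
open import Data.List.Membership.Propositional.Properties
  using (∈-filter⁺; ∈-filter⁻; ∈-++⁺ˡ; ∈-++⁺ʳ; ∈-++⁻)
open import Data.List.Relation.Unary.All using (lookup)
open import Data.List.Relation.Unary.All.Properties using (¬All⇒Any¬)
open import Data.List.Relation.Unary.Any using (any?)
open import Data.Nat using (ℕ; _≟_)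
open import Data.Product using (∃; _×_; _,_)
open import Data.Sum using (_⊎_; inj₁; inj₂; swap)
open import Function using (_∘_; id)
open import Function.Bundles using (mk⇔; Equivalence)
open import Relation.Nullary using (¬_; Dec; yes; no; ¬?)
open import Relation.Nullary.Decidable using (map′; decidable-stable)
open import Relation.Binary.PropositionalEquality using (_≡_; _≢_; refl; sym; trans; cong)

var : Lit → ℕ
var (pos v) = v
var (neg v) = v

compl : Lit → Lit
compl (pos v) = neg v
compl (neg v) = pos v

_≟ˡ_ : (l m : Lit) → Dec (l ≡ m)
pos x ≟ˡ pos y = map′ (cong pos) (λ { refl → refl }) (x ≟ y)
pos x ≟ˡ neg y = no λ ()
neg x ≟ˡ pos y = no λ ()
neg x ≟ˡ neg y = map′ (cong neg) (λ { refl → refl }) (x ≟ y)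

same-var : ∀ l m → var m ≡ var l → m ≡ l ⊎ m ≡ compl l
same-var (pos x) (pos .x) refl = inj₁ refl
same-var (pos x) (neg .x) refl = inj₂ refl
same-var (neg x) (pos .x) refl = inj₂ refl
same-var (neg x) (neg .x) refl = inj₁ refl

compl⇒Tautology : ∀ {c l} → l ∈ c → compl l ∈ c → Tautology c
compl⇒Tautology {l = pos x} l∈c l̄∈c = x , l∈c , l̄∈c
compl⇒Tautology {l = neg x} l∈c l̄∈c = x , l̄∈c , l∈c

≈-refl : ∀ {c} → c ≈ c
≈-refl _ = mk⇔ id id

Sat-resp-≈ : ∀ {α c d} → c ≈ d → Sat α d → Sat α c
Sat-resp-≈ c≈d s with find s
... | m , m∈d , m-true = lose (Equivalence.from (c≈d m) m∈d) m-true

sat? : (α : Assignment) (c : Clause) → Dec (Sat α c)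
sat? α = any? (λ l → evalLit α l ≟ᵇ true)

Falsifies : Assignment → Clause → Set
Falsifies α c = ∀ {m} → m ∈ c → evalLit α m ≡ false

¬Sat⇒Falsifies : ∀ {α c} → ¬ Sat α c → Falsifies α c
¬Sat⇒Falsifies ¬s m∈c = ¬-not (¬s ∘ lose m∈c)

Falsifies⇒¬Sat : ∀ {α c} → Falsifies α c → ¬ Sat α c
Falsifies⇒¬Sat f s with find s
... | m , m∈c , m-true with trans (sym m-true) (f m∈c)
...   | ()

Falsifies-≉ : ∀ {α c d} → Falsifies α d → Sat α c → ¬ (d ≈ c)
Falsifies-≉ f s d≈c = Falsifies⇒¬Sat f (Sat-resp-≈ d≈c s)

Falsifies⇒¬Tautology : ∀ {α c} → Falsifies α c → ¬ Tautology c
Falsifies⇒¬Tautology {α} f (v , p∈c , n∈c) with α v | f p∈c | f n∈c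
... | false | _ | ()

falsified-member : ∀ {F c β} → F ⊨ c → ¬ Sat β c → ∃ λ d → d ∈ F × Falsifies β d
falsified-member {F} {β = β} F⊨c ¬s with find (¬All⇒Any¬ (sat? β) F (¬s ∘ F⊨c β))
... | d , d∈F , ¬sd = d , d∈F , ¬Sat⇒Falsifies ¬sd

flipVar : Assignment → ℕ → Assignment
flipVar α v x with x ≟ v
... | yes _ = not (α x)
... | no _ = α x

flipVar-self : ∀ α l → evalLit (flipVar α (var l)) l ≡ not (evalLit α l)
flipVar-self α (pos x) with x ≟ x
... | yes _ = refl
... | no x≢x = ⊥-elim (x≢x refl)
flipVar-self α (neg x) with x ≟ x
... | yes _ = refl
... | no x≢x = ⊥-elim (x≢x refl)

flipVar-Sat : ∀ {α l c} → evalLit α l ≡ false → l ∈ c → Sat (flipVar α (var l)) c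
flipVar-Sat {α} {l} αl l∈c = lose l∈c (trans (flipVar-self α l) (cong not αl))

flipVar-other : ∀ α v m → var m ≢ v → evalLit (flipVar α v) m ≡ evalLit α m
flipVar-other α v (pos x) x≢v with x ≟ v
... | yes x≡v = ⊥-elim (x≢v x≡v)
... | no _ = refl
flipVar-other α v (neg x) x≢v with x ≟ v
... | yes x≡v = ⊥-elim (x≢v x≡v)
... | no _ = refl

Falsifies-flipVar-fresh : ∀ {α v d} → (∀ {m} → m ∈ d → var m ≢ v) →
  Falsifies α d → Falsifies (flipVar α v) d
Falsifies-flipVar-fresh {α} {v} fresh f {m} m∈d =
  trans (flipVar-other α v m (fresh m∈d)) (f m∈d)

Falsifies-unflip : ∀ {α l d} → Falsifies (flipVar α (var l)) d → evalLit α l ≡ false →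
  ∀ {m} → m ∈ d → m ≢ compl l → evalLit α m ≡ false
Falsifies-unflip {α} {l} f αl {m} m∈d m≢l̄ with var m ≟ var l
... | no m≢l = trans (sym (flipVar-other α (var l) m m≢l)) (f m∈d)
... | yes m~l with same-var l m m~l
...   | inj₁ refl = αl
...   | inj₂ m≡l̄ = ⊥-elim (m≢l̄ m≡l̄)

compl∈-flipVar : ∀ {α l d} → Sat α d → Falsifies (flipVar α (var l)) d →
  evalLit α l ≡ false → compl l ∈ d
compl∈-flipVar {α} {l} s f αl with find s
... | m , m∈d , m-true with m ≟ˡ compl l
...   | yes refl = m∈d
...   | no m≢l̄ with trans (sym m-true) (Falsifies-unflip f αl m∈d m≢l̄)
...     | ()

without : Lit → Clause → Clause
without l = filter (λ m → ¬? (m ≟ˡ l))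

resolvent : Clause → Clause → ℕ → Clause
resolvent d₁ d₂ v = without (pos v) d₁ ++ without (neg v) d₂

resolvent-IsResolvent : ∀ d₁ d₂ v → IsResolvent d₁ d₂ v (resolvent d₁ d₂ v)
resolvent-IsResolvent d₁ d₂ v l = mk⇔ to from
  where
  to : l ∈ resolvent d₁ d₂ v → (l ∈ d₁ × l ≢ pos v) ⊎ (l ∈ d₂ × l ≢ neg v)
  to l∈r with ∈-++⁻ (without (pos v) d₁) l∈r
  ... | inj₁ l∈ = inj₁ (∈-filter⁻ (λ m → ¬? (m ≟ˡ pos v)) l∈)
  ... | inj₂ l∈ = inj₂ (∈-filter⁻ (λ m → ¬? (m ≟ˡ neg v)) l∈)
  from : (l ∈ d₁ × l ≢ pos v) ⊎ (l ∈ d₂ × l ≢ neg v) → l ∈ resolvent d₁ d₂ v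
  from (inj₁ (l∈ , l≢)) = ∈-++⁺ˡ (∈-filter⁺ (λ m → ¬? (m ≟ˡ pos v)) l∈ l≢)
  from (inj₂ (l∈ , l≢)) = ∈-++⁺ʳ _ (∈-filter⁺ (λ m → ¬? (m ≟ˡ neg v)) l∈ l≢)

-- One direction of IsResolvent, with the pivot literal l of either sign.
ResolventOn : Clause → Clause → Lit → Clause → Set
ResolventOn d₁ d₂ l r = ∀ {m} → m ∈ r → (m ∈ d₁ × m ≢ l) ⊎ (m ∈ d₂ × m ≢ compl l)

resolve : ∀ {F d₁ d₂} l → ResCn F d₁ → ResCn F d₂ → l ∈ d₁ → compl l ∈ d₂ →
  (∀ r → ResolventOn d₁ d₂ l r → ¬ Tautology r) →
  ∃ λ r → ResCn F r × ResolventOn d₁ d₂ l r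
resolve {d₁ = d₁} {d₂} (pos v) R₁ R₂ l∈ l̄∈ ¬taut =
  r , res v R₁ R₂ l∈ l̄∈ r-res (¬taut r on) , on
  where
  r = resolvent d₁ d₂ v
  r-res = resolvent-IsResolvent d₁ d₂ v
  on : ResolventOn d₁ d₂ (pos v) r
  on {m} = Equivalence.to (r-res m)
resolve {d₁ = d₁} {d₂} (neg v) R₁ R₂ l∈ l̄∈ ¬taut =
  r , res v R₂ R₁ l̄∈ l∈ r-res (¬taut r on) , on
  where
  r = resolvent d₂ d₁ v
  r-res = resolvent-IsResolvent d₂ d₁ v
  on : ResolventOn d₁ d₂ (neg v) r
  on {m} = swap ∘ Equivalence.to (r-res m)

ResolventOn-Falsifies : ∀ {α d₁ d₂ l r} →
  (∀ {m} → m ∈ d₁ → m ≢ l → evalLit α m ≡ false) →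
  (∀ {m} → m ∈ d₂ → m ≢ compl l → evalLit α m ≡ false) →
  ResolventOn d₁ d₂ l r → Falsifies α r
ResolventOn-Falsifies f₁ f₂ on m∈r with on m∈r
... | inj₁ (m∈ , m≢) = f₁ m∈ m≢
... | inj₂ (m∈ , m≢) = f₂ m∈ m≢

flipVar-countermodel : ∀ {F α c c' l} → ¬ Tautology c → Falsifies α c → l ∈ c →
  c' ⊆ c → l ∉ c' → F ⊨ c' → ∃ λ d → d ∈ F × Falsifies (flipVar α (var l)) d
flipVar-countermodel {c' = c'} {l = l} ¬taut c-false l∈c c'⊆c l∉c' F⊨c' =
  falsified-member F⊨c' (Falsifies⇒¬Sat (Falsifies-flipVar-fresh c'-fresh (c-false ∘ c'⊆c)))
  where
  c'-fresh : ∀ {m} → m ∈ c' → var m ≢ var l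
  c'-fresh {m} m∈c' m~l with same-var l m m~l
  ... | inj₁ refl = l∉c' m∈c'
  ... | inj₂ refl = ¬taut (compl⇒Tautology l∈c (c'⊆c m∈c'))

flipVar-resolvent : ∀ {F α c d l} → ¬ Tautology d → ResCn F c → ResCn F d →
  Falsifies α c → l ∈ c → Sat α d → Falsifies (flipVar α (var l)) d →
  ∃ λ r → ResCn F r × Falsifies α r × l ∉ r
flipVar-resolvent {α = α} {c = c} {d = d} {l = l} ¬taut-d Rc Rd c-false l∈c αd βd-false =
  let r , r∈ResCn , r-on = resolve l Rc Rd l∈c l̄∈d (λ _ → Falsifies⇒¬Tautology ∘ falsifies)
  in r , r∈ResCn , falsifies r-on , l∉ r-on
  where
  αl = c-false l∈c
  l̄∈d = compl∈-flipVar αd βd-false αl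
  falsifies : ∀ {r} → ResolventOn c d l r → Falsifies α r
  falsifies = ResolventOn-Falsifies (λ m∈c _ → c-false m∈c) (Falsifies-unflip βd-false αl)
  l∉ : ∀ {r} → ResolventOn c d l r → l ∉ r
  l∉ r-on l∈r with r-on l∈r
  ... | inj₁ (_ , l≢l) = l≢l refl
  ... | inj₂ (l∈d , _) = ¬taut-d (compl⇒Tautology l∈d l̄∈d)

corollary2 : (F : CNF) → WellFormed F → (c c' : Clause) → c ∈ F →
    c' ⊊ c → F ⊨ c' → Superredundant F c
corollary2 F wf c c' c∈F (c'⊆c , l , l∈c , l∉c') F⊨c' α others =
  decidable-stable (sat? α c) (refute ∘ ¬Sat⇒Falsifies)
  where
  refute : Falsifies α c → ⊥
  refute c-false =
    let d , d∈F , βd-false = flipVar-countermodel (lookup wf c∈F) c-false l∈c c'⊆c l∉c' F⊨c'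
        d≉c = Falsifies-≉ βd-false (flipVar-Sat (c-false l∈c) l∈c)
        αd = others d (base d∈F ≈-refl) d≉c
        r , r∈ResCn , r-false , l∉r = flipVar-resolvent (lookup wf d∈F)
          (base c∈F ≈-refl) (base d∈F ≈-refl) c-false l∈c αd βd-false
        r≉c = λ r≈c → l∉r (Equivalence.from (r≈c l) l∈c)
    in Falsifies⇒¬Sat r-false (others r r∈ResCn r≉c)
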